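{- Let $(p,q)=(2,3)$ and $U\in\mathbb{N}$. Then $W(U)=1$ if and only if either $U\in\{0,1\}$ or $U=2^a\cdot3-1$ for some $a\in\mathbb{N}$. Moreover, $W(U)=2$ if and only if either $U\in\{3,4,6,7\}$, or $U=2^a\cdot9-1$, or $U=2^a\cdot15-1$ for some $a\in\mathbb{N}$.
   Context: A strictly chained $(2,3)$-ary partition of $U$ is a finite sequence of distinct positive integers of the form $2^a3^b$ ($a,b\ge0$) summing to $U$, in decreasing order, each part a multiple of the next. $W(U)$ is the number of such partitions of $U$, with $W(0)=1$ (the empty partition). -}

module Defs where

open import Data.Nat using (ℕ; zero; suc; _+_; _*_; _^_; _<_; _≟_; _<?_)
open import Data.Nat.Divisibility using (_∣_; _∣?_)
open import Data.Fin using (Fin; toℕ)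
open import Data.Fin.Properties using (any?)
open import Data.List using (List; []; _∷_; length; filter; map; downFrom; _++_)
open import Data.Nat.ListAction using (sum)
open import Data.List.Relation.Unary.All using (All; all?)
open import Data.List.Relation.Unary.Linked using (Linked; linked?)
open import Data.Product using (Σ; _×_; _,_)
open import Relation.Binary.PropositionalEquality using (_≡_)
open import Relation.Nullary using (Dec)
open import Relation.Nullary.Decidable using (_×-dec_)

-- n is of the form 2^a * 3^b.  Since 2^a * 3^b = n forces a , b ≤ n,
-- the exponents are taken from Fin (suc n) (this only makes the
-- predicate decidable; it is the same set of numbers).
Is23 : ℕ → Set
Is23 n = Σ (Fin (suc n)) λ a → Σ (Fin (suc n)) λ b → n ≡ 2 ^ toℕ a * 3 ^ toℕ b

is23? : (n : ℕ) → Dec (Is23 n)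
is23? n = any? λ a → any? λ b → n ≟ 2 ^ toℕ a * 3 ^ toℕ b

ChainStep : ℕ → ℕ → Set
ChainStep x y = (y < x) × (y ∣ x)

chainStep? : (x y : ℕ) → Dec (ChainStep x y)
chainStep? x y = (y <? x) ×-dec (y ∣? x)

IsSCPartition : ℕ → List ℕ → Set
IsSCPartition U xs = (sum xs ≡ U) × All Is23 xs × Linked ChainStep xs

isSCPartition? : (U : ℕ) → (xs : List ℕ) → Dec (IsSCPartition U xs)
isSCPartition? U xs =
  (sum xs ≟ U) ×-dec (all? is23? xs ×-dec linked? chainStep? xs)

sublists : {A : Set} → List A → List (List A)
sublists [] = [] ∷ []
sublists (x ∷ xs) = map (x ∷_) (sublists xs) ++ sublists xs

-- candidates: all sublists of [U, U-1, ..., 1], i.e. all strictly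
-- decreasing lists of positive integers ≤ U (each listed once).
-- Every strictly chained partition of U is among them.
candidates : ℕ → List (List ℕ)
candidates U = sublists (map suc (downFrom U))

W : ℕ → ℕ
W U = length (filter (isSCPartition? U) (candidates U))

module Submission where

-- The proof rests on the recurrence W(2k + 1) = W k for 3 ∣ k + 1: the last
-- part of a partition of 2k + 1 is then forced to be 1 and all other parts
-- to be even, so such partitions are exactly "lift 2 zs" (double every part
-- of a partition zs of k, append 1).  Iterating along the orbit
-- n ↦ 2n + 1 of 2, 8 and 14 gives W = 1 resp. 2 on the two families.
-- Conversely, induction along binary expansions shows that every other U
-- has three distinct partitions: doubling and lifting transport partitions
-- from k to 2k and 2k + 1, and when 2k = 3j + 1 the doubled partitions of k
-- and the partitions of j lifted by 3 (tripled, with 1 appended) add up.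

open import Defs
open import Data.Nat using (ℕ; zero; suc; _+_; _*_; _^_; _∸_; _≤_; _<_; z≤n; s≤s; z<s;
  NonZero; NonTrivial; nonTrivial⇒nonZero; nonTrivial⇒n>1; nonTrivial⇒≢1)
open import Data.Nat.Divisibility
  using (_∣_; divides; ∣-trans; ∣1⇒≡1; 1∣_; _∣0; ∣⇒≤; ∣m∣n⇒∣m+n; ∣m+n∣m⇒∣n;
         m∣m*n; n∣m*n; *-monoʳ-∣; *-cancelˡ-∣)
open import Data.Nat.Coprimality using (Coprime; coprime-divisor; gcd≡1⇒coprime)
  renaming (sym to coprime-sym)
open import Data.Nat.Properties
open import Data.Nat.ListAction using (sum)
open import Data.Nat.ListAction.Properties using (sum-++)
open import Data.Nat.Induction using (<-rec)
open import Data.Nat.Tactic.RingSolver using (solve-∀)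
open import Data.Fin using (toℕ; fromℕ<)
open import Data.Fin.Properties using (toℕ-fromℕ<)
open import Data.List
  using (List; []; _∷_; [_]; length; filter; map; downFrom; _++_; _∷ʳ_; initLast; _∷ʳ′_)
open import Data.List.Properties
  using (∷-injective; ∷ʳ-injectiveˡ; map-injective; length-map; length-++; ≡-dec)
open import Data.List.Membership.Propositional using (_∈_)
open import Data.List.Membership.Propositional.Properties
  using (∈-++⁺ˡ; ∈-++⁺ʳ; ∈-++⁻; ∈-map⁺; ∈-map⁻; ∈-∃++; ∈-filter⁺; ∈-filter⁻)
open import Data.List.Relation.Unary.Any using (here; there)
open import Data.List.Relation.Unary.All as All using (All; []; _∷_; all?)
import Data.List.Relation.Unary.All.Properties as AllProps
open AllProps using (All¬⇒¬Any)
open import Data.List.Relation.Unary.AllPairs using ([]; _∷_)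
open import Data.List.Relation.Unary.Linked using (Linked)
import Data.List.Relation.Unary.Linked as Linked
import Data.List.Relation.Unary.Linked.Properties as LinkedProps
open LinkedProps using (Linked⇒AllPairs)
open import Data.List.Relation.Unary.Unique.Propositional using (Unique)
open import Data.List.Relation.Unary.Unique.DecPropositional (≡-dec Data.Nat._≟_) using (unique?)
import Data.List.Relation.Unary.Unique.Propositional.Properties as Unique
open import Data.List.Relation.Binary.Permutation.Propositional.Properties
  using (↭-length; ∈-resp-↭; shift)
open import Data.List.Relation.Binary.Sublist.Propositional as Sublist
  using (_⊆_; []; _∷_) renaming (_∷ʳ_ to skip)
open import Data.Product using (∃; ∃₂; _×_; _,_; proj₁; proj₂)
open import Data.Sum using (_⊎_; inj₁; inj₂; map₂)
import Data.Sum as Sum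
open import Data.Empty using (⊥-elim)
open import Relation.Nullary using (¬_)
open import Relation.Nullary.Decidable using (True; toWitness)
open import Function.Bundles using (_⇔_; mk⇔; Equivalence)
open import Relation.Binary.PropositionalEquality hiding ([_])

⊆⇒∈sublists : ∀ {A : Set} {xs ys : List A} → xs ⊆ ys → xs ∈ sublists ys
⊆⇒∈sublists [] = here refl
⊆⇒∈sublists (skip {ys = ys} y s) = ∈-++⁺ʳ (map (y ∷_) (sublists ys)) (⊆⇒∈sublists s)
⊆⇒∈sublists (refl ∷ s) = ∈-++⁺ˡ (∈-map⁺ _ (⊆⇒∈sublists s))

∈sublists⇒⊆ : ∀ {A : Set} {xs : List A} (ys : List A) → xs ∈ sublists ys → xs ⊆ ys
∈sublists⇒⊆ [] (here refl) = []
∈sublists⇒⊆ (y ∷ ys) m with ∈-++⁻ (map (y ∷_) (sublists ys)) m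
... | inj₂ m′ = skip y (∈sublists⇒⊆ ys m′)
... | inj₁ m′ with ∈-map⁻ (y ∷_) m′
...   | _ , m″ , refl = refl ∷ ∈sublists⇒⊆ ys m″

-- The sublists of a duplicate-free list are pairwise distinct: those
-- containing the head y cannot be sublists of the tail, which avoids y.
sublists-unique : ∀ {A : Set} (ys : List A) → Unique ys → Unique (sublists ys)
sublists-unique [] _ = [] ∷ []
sublists-unique (y ∷ ys) (y∉ys ∷ u) =
  Unique.++⁺ (Unique.map⁺ (λ eq → proj₂ (∷-injective eq)) (sublists-unique ys u))
             (sublists-unique ys u) with-head∉tail
  where
  with-head∉tail : ∀ {v} → ¬ (v ∈ map (y ∷_) (sublists ys) × v ∈ sublists ys)
  with-head∉tail (m₁ , m₂) with ∈-map⁻ (y ∷_) m₁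
  ... | _ , _ , refl = All¬⇒¬Any y∉ys (Sublist.lookup (∈sublists⇒⊆ ys m₂) (here refl))

candidates-unique : ∀ U → Unique (candidates U)
candidates-unique U = sublists-unique _ (Unique.map⁺ suc-injective (Unique.downFrom⁺ U))

Decreasing : List ℕ → Set
Decreasing = Linked (λ x y → y < x)

below-head : ∀ {x xs} → Decreasing (x ∷ xs) → All (_< x) xs
below-head dec with below ∷ _ ← Linked⇒AllPairs (λ y<x z<y → <-trans z<y y<x) dec = below

decreasing⊆range : ∀ n {xs} → Decreasing xs → All (λ x → 1 ≤ x × x ≤ n) xs →
                   xs ⊆ map suc (downFrom n)
decreasing⊆range zero    {[]}     _   _ = []
decreasing⊆range zero    {x ∷ xs} _   ((1≤x , x≤0) ∷ _) = ⊥-elim (<-irrefl refl (≤-trans 1≤x x≤0))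
decreasing⊆range (suc n) {[]}     _   _ = skip (suc n) (decreasing⊆range n Linked.[] [])
decreasing⊆range (suc n) {x ∷ xs} dec ((1≤x , x≤n+1) ∷ bounds)
  with m≤n⇒m<n∨m≡n x≤n+1
... | inj₁ x<n+1 = skip (suc n) (decreasing⊆range n dec ((1≤x , ≤-pred x<n+1) ∷ lowered))
  where
  lowered : All (λ y → 1 ≤ y × y ≤ n) xs
  lowered = All.zipWith (λ ((1≤y , _) , y<x) → 1≤y , ≤-pred (<-trans y<x x<n+1))
                        (bounds , below-head dec)
... | inj₂ refl = refl ∷ decreasing⊆range n (Linked.tail dec) lowered
  where
  lowered : All (λ y → 1 ≤ y × y ≤ n) xs
  lowered = All.zipWith (λ ((1≤y , _) , y<x) → 1≤y , ≤-pred y<x) (bounds , below-head dec)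

PowerProduct : ℕ → ℕ → ℕ → Set
PowerProduct p q n = ∃₂ λ a b → n ≡ p ^ a * q ^ b

pp-swap : ∀ {p q n} → PowerProduct p q n → PowerProduct q p n
pp-swap {p} {q} (a , b , eq) = b , a , trans eq (*-comm (p ^ a) (q ^ b))

pp-*ˡ : ∀ {p q n} → PowerProduct p q n → PowerProduct p q (p * n)
pp-*ˡ {p} {q} (a , b , refl) = suc a , b , sym (*-assoc p (p ^ a) (q ^ b))

∤power : ∀ {d m} .{{_ : NonTrivial d}} → Coprime d m → ∀ n → ¬ d ∣ m ^ n
∤power _ zero    d∣1 = nonTrivial⇒≢1 (∣1⇒≡1 d∣1)
∤power c (suc n) d∣m^n+1 = ∤power c n (coprime-divisor c d∣m^n+1)

pp-cancelˡ : ∀ {p q n} .{{_ : NonTrivial p}} → Coprime p q →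
             PowerProduct p q (p * n) → PowerProduct p q n
pp-cancelˡ {p} {q} {n} c (zero , b , eq) =
  ⊥-elim (∤power c b (divides n (trans (sym (+-identityʳ (q ^ b))) (trans (sym eq) (*-comm p n)))))
pp-cancelˡ {p} {q} {n} c (suc a , b , eq) =
  a , b , *-cancelˡ-≡ n _ p {{nonTrivial⇒nonZero p}} (trans eq (*-assoc p (p ^ a) (q ^ b)))

pp-cases : ∀ {p q n} → PowerProduct p q n → n ≡ 1 ⊎ p ∣ n ⊎ q ∣ n
pp-cases             (zero  , zero  , refl) = inj₁ refl
pp-cases {p} {q}     (suc a , b     , refl) = inj₂ (inj₁ (∣-trans (m∣m*n (p ^ a)) (m∣m*n (q ^ b))))
pp-cases {p} {q}     (zero  , suc b , refl) = inj₂ (inj₂ (∣-trans (m∣m*n (q ^ b)) (n∣m*n 1)))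

pp-positive : ∀ {p q n} .{{_ : NonZero p}} .{{_ : NonZero q}} → PowerProduct p q n → 1 ≤ n
pp-positive {p} {q} (a , b , refl) = *-mono-≤ (m^n>0 p a) (m^n>0 q b)

n<m^n : ∀ m .{{_ : NonTrivial m}} n → n < m ^ n
n<m^n m zero    = z<s
n<m^n m (suc n) = ≤-<-trans (n<m^n m n)
  (subst (_< m * m ^ n) (*-identityˡ (m ^ n))
         (*-monoˡ-< (m ^ n) {{m^n≢0 m n {{nonTrivial⇒nonZero m}}}} (nonTrivial⇒n>1 m)))

-- Is23 bounds the exponents only to make it decidable; the bound holds anyway.
Is23⇒pp : ∀ {n} → Is23 n → PowerProduct 2 3 n
Is23⇒pp (a , b , eq) = toℕ a , toℕ b , eq

pp⇒Is23 : ∀ {n} → PowerProduct 2 3 n → Is23 n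
pp⇒Is23 {n} (a , b , eq) =
  fromℕ< (s≤s a≤n) , fromℕ< (s≤s b≤n) ,
  trans eq (cong₂ (λ x y → 2 ^ x * 3 ^ y) (sym (toℕ-fromℕ< (s≤s a≤n))) (sym (toℕ-fromℕ< (s≤s b≤n))))
  where
  a≤n : a ≤ n
  a≤n = ≤-trans (<⇒≤ (n<m^n 2 a)) (subst (2 ^ a ≤_) (sym eq) (m≤m*n (2 ^ a) (3 ^ b) {{m^n≢0 3 b}}))
  b≤n : b ≤ n
  b≤n = ≤-trans (<⇒≤ (n<m^n 3 b)) (subst (3 ^ b ≤_) (sym eq) (m≤n*m (3 ^ b) (2 ^ a) {{m^n≢0 2 a}}))

coprime-2-3 : Coprime 2 3
coprime-2-3 = gcd≡1⇒coprime refl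

Is23-×2 : ∀ {y} → Is23 (2 * y) ⇔ Is23 y
Is23-×2 = mk⇔ (λ i → pp⇒Is23 (pp-cancelˡ coprime-2-3 (Is23⇒pp i)))
              (λ i → pp⇒Is23 (pp-*ˡ (Is23⇒pp i)))

Is23-×3 : ∀ {y} → Is23 (3 * y) ⇔ Is23 y
Is23-×3 = mk⇔ (λ i → pp⇒Is23 (pp-swap (pp-cancelˡ (coprime-sym coprime-2-3) (pp-swap (Is23⇒pp i)))))
              (λ i → pp⇒Is23 (pp-swap (pp-*ˡ (pp-swap (Is23⇒pp i)))))

Is23-positive : ∀ {n} → Is23 n → 1 ≤ n
Is23-positive i = pp-positive (Is23⇒pp i)

unique-length-≤ : ∀ {A : Set} {xs : List A} (ys : List A) → Unique xs →
                  (∀ {x} → x ∈ xs → x ∈ ys) → length xs ≤ length ys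
unique-length-≤ {xs = []} _ _ _ = z≤n
unique-length-≤ {xs = x ∷ xs} ys (x∉xs ∷ u) xs⊆ys
  with ys₁ , ys₂ , refl ← ∈-∃++ (xs⊆ys (here refl)) =
  subst (suc (length xs) ≤_) (sym (↭-length (shift x ys₁ ys₂)))
        (s≤s (unique-length-≤ (ys₁ ++ ys₂) u xs⊆rest))
  where
  xs⊆rest : ∀ {y} → y ∈ xs → y ∈ ys₁ ++ ys₂
  xs⊆rest y∈xs with ∈-resp-↭ (shift x ys₁ ys₂) (xs⊆ys (there y∈xs))
  ... | here refl = ⊥-elim (All¬⇒¬Any x∉xs y∈xs)
  ... | there y∈rest = y∈rest

part≤sum : ∀ {x} xs → x ∈ xs → x ≤ sum xs
part≤sum (y ∷ xs) (here refl) = m≤m+n y (sum xs)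
part≤sum (y ∷ xs) (there x∈xs) = ≤-trans (part≤sum xs x∈xs) (m≤n+m (sum xs) y)

partition∈candidates : ∀ {U xs} → IsSCPartition U xs → xs ∈ candidates U
partition∈candidates {U} {xs} (sum≡U , is23 , chain) =
  ⊆⇒∈sublists (decreasing⊆range U (Linked.map proj₁ chain)
    (All.zipWith (λ (i , x≤U) → Is23-positive i , x≤U)
                 (is23 , All.tabulate (λ x∈xs → subst (_ ≤_) sum≡U (part≤sum xs x∈xs)))))

record Partitions (n U : ℕ) : Set where
  constructor partitions
  field
    list     : List (List ℕ)
    distinct : Unique list
    valid    : All (IsSCPartition U) list
    size     : length list ≡ n

enumeration : ∀ U → Partitions (W U) U
enumeration U = partitions (filter (isSCPartition? U) (candidates U))
  (Unique.filter⁺ (isSCPartition? U) (candidates-unique U))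
  (All.tabulate λ m → proj₂ (∈-filter⁻ (isSCPartition? U) {xs = candidates U} m))
  refl

∈enumeration : ∀ {U xs} → IsSCPartition U xs → xs ∈ Partitions.list (enumeration U)
∈enumeration p = ∈-filter⁺ (isSCPartition? _) (partition∈candidates p) p

Partitions⇒≤W : ∀ {n U} → Partitions n U → n ≤ W U
Partitions⇒≤W {U = U} (partitions L distinct valid refl) =
  unique-length-≤ _ distinct (λ m → ∈enumeration (All.lookup valid m))

W≤length : ∀ {U} (L : List (List ℕ)) → (∀ {xs} → IsSCPartition U xs → xs ∈ L) → W U ≤ length L
W≤length {U} L complete = unique-length-≤ L (Partitions.distinct (enumeration U))
  (λ m → complete (All.lookup (Partitions.valid (enumeration U)) m))

linked-snoc⁺ : ∀ {A : Set} {R : A → A → Set} {z} ys →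
               Linked R ys → All (λ y → R y z) ys → Linked R (ys ∷ʳ z)
linked-snoc⁺ []            _       _        = Linked.[-]
linked-snoc⁺ (y ∷ [])      _       (r ∷ []) = r Linked.∷ Linked.[-]
linked-snoc⁺ (y ∷ y′ ∷ ys) (r Linked.∷ l) (_ ∷ rs) = r Linked.∷ linked-snoc⁺ (y′ ∷ ys) l rs

linked-snoc⁻ : ∀ {A : Set} {R : A → A → Set} {z} → (∀ {x y w} → R x y → R y w → R x w) →
               ∀ ys → Linked R (ys ∷ʳ z) → Linked R ys × All (λ y → R y z) ys
linked-snoc⁻ _     []            _         = Linked.[] , []
linked-snoc⁻ _     (y ∷ [])      (r Linked.∷ _) = Linked.[-] , r ∷ []
linked-snoc⁻ trans (y ∷ y′ ∷ ys) (r Linked.∷ l)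
  with l′ , rs@(r′ ∷ _) ← linked-snoc⁻ trans (y′ ∷ ys) l = r Linked.∷ l′ , trans r r′ ∷ rs

chainStep-trans : ∀ {x y z} → ChainStep x y → ChainStep y z → ChainStep x z
chainStep-trans (y<x , y∣x) (z<y , z∣y) = <-trans z<y y<x , ∣-trans z∣y y∣x

sum-map-* : ∀ k xs → sum (map (k *_) xs) ≡ k * sum xs
sum-map-* k []       = sym (*-zeroʳ k)
sum-map-* k (x ∷ xs) = trans (cong (k * x +_) (sum-map-* k xs)) (sym (*-distribˡ-+ k x (sum xs)))

chainStep-scale : ∀ k .{{_ : NonZero k}} {x y} → ChainStep x y ⇔ ChainStep (k * x) (k * y)
chainStep-scale k {x} {y} = mk⇔ (λ (y<x , y∣x) → *-monoʳ-< k y<x , *-monoʳ-∣ k y∣x)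
                                (λ (ky<kx , ky∣kx) → *-cancelˡ-< k y x ky<kx , *-cancelˡ-∣ k ky∣kx)

scale-partition : ∀ k .{{_ : NonZero k}} → (∀ {y} → Is23 (k * y) ⇔ Is23 y) →
                  ∀ {m zs} → IsSCPartition m zs ⇔ IsSCPartition (k * m) (map (k *_) zs)
scale-partition k Is23-×k {m} {zs} = mk⇔
  (λ (sum≡m , is23 , chain) →
     trans (sum-map-* k zs) (cong (k *_) sum≡m) ,
     AllProps.map⁺ (All.map (Equivalence.from Is23-×k) is23) ,
     LinkedProps.map⁺ (Linked.map (Equivalence.to (chainStep-scale k)) chain))
  (λ (sum≡km , is23 , chain) →
     *-cancelˡ-≡ (sum zs) m k (trans (sym (sum-map-* k zs)) sum≡km) ,
     All.map (Equivalence.to Is23-×k) (AllProps.map⁻ is23) ,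
     Linked.map (Equivalence.from (chainStep-scale k)) (LinkedProps.map⁻ chain))

divisible⇒scaled : ∀ k .{{_ : NonZero k}} xs → All (k ∣_) xs → ∃ λ zs → xs ≡ map (k *_) zs
divisible⇒scaled k []       []                       = [] , refl
divisible⇒scaled k (x ∷ xs) (divides q x≡qk ∷ k∣xs) with zs , refl ← divisible⇒scaled k xs k∣xs =
  q ∷ zs , cong (_∷ map (k *_) zs) (trans x≡qk (*-comm q k))

final-one : ∀ {n ys} → (IsSCPartition n ys × All (1 <_) ys) ⇔ IsSCPartition (suc n) (ys ∷ʳ 1)
final-one {n} {ys} = mk⇔
  (λ ((sum≡n , is23 , chain) , ys>1) →
     trans sum-snoc (cong suc sum≡n) ,
     AllProps.++⁺ is23 (pp⇒Is23 (0 , 0 , refl) ∷ []) ,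
     linked-snoc⁺ ys chain (All.map (λ 1<y → 1<y , 1∣ _) ys>1))
  (λ (sum≡n+1 , is23 , chain) →
     let chain′ , steps = linked-snoc⁻ chainStep-trans ys chain in
     (suc-injective (trans (sym sum-snoc) sum≡n+1) , AllProps.++⁻ˡ ys is23 , chain′) ,
     All.map proj₁ steps)
  where
  sum-snoc : sum (ys ∷ʳ 1) ≡ suc (sum ys)
  sum-snoc = trans (sum-++ ys [ 1 ]) (+-comm (sum ys) 1)

divides-last⇒divides-all : ∀ {d z} ys → Linked ChainStep (ys ∷ʳ z) → d ∣ z → All (d ∣_) (ys ∷ʳ z)
divides-last⇒divides-all ys chain d∣z =
  AllProps.++⁺ (All.map (λ (_ , z∣y) → ∣-trans d∣z z∣y) (proj₂ (linked-snoc⁻ chainStep-trans ys chain)))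
               (d∣z ∷ [])

-- The last part of a partition is of the form 2^a 3^b, so it is 1, even,
-- or a multiple of 3.
data Shape : List ℕ → Set where
  empty     : Shape []
  all-even  : ∀ {xs} → All (2 ∣_) xs → Shape xs
  all-by-3  : ∀ {xs} → All (3 ∣_) xs → Shape xs
  ends-in-1 : ∀ ys → Shape (ys ∷ʳ 1)

shape : ∀ {U xs} → IsSCPartition U xs → Shape xs
shape {xs = xs} (_ , is23 , chain) with initLast xs
... | [] = empty
... | ys ∷ʳ′ z with pp-cases (Is23⇒pp (All.head (AllProps.++⁻ʳ ys is23)))
...   | inj₁ refl        = ends-in-1 ys
...   | inj₂ (inj₁ 2∣z) = all-even (divides-last⇒divides-all ys chain 2∣z)
...   | inj₂ (inj₂ 3∣z) = all-by-3 (divides-last⇒divides-all ys chain 3∣z)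

lift : ℕ → List ℕ → List ℕ
lift k zs = map (k *_) zs ∷ʳ 1

lift-partition : ∀ k .{{_ : NonTrivial k}} → (∀ {y} → Is23 (k * y) ⇔ Is23 y) →
                 ∀ {m zs} → IsSCPartition m zs → IsSCPartition (suc (k * m)) (lift k zs)
lift-partition k Is23-×k p@(_ , is23 , _) = Equivalence.to final-one
  (Equivalence.to (scale-partition k {{nonTrivial⇒nonZero k}} Is23-×k) p ,
   AllProps.map⁺ (All.map k*z>1 is23))
  where
  k*z>1 : ∀ {z} → Is23 z → 1 < k * z
  k*z>1 {z} i = <-≤-trans (nonTrivial⇒n>1 k)
                          (subst (_≤ k * z) (*-identityʳ k) (*-monoʳ-≤ k (Is23-positive i)))

lift-injective : ∀ k .{{_ : NonZero k}} {as bs} → lift k as ≡ lift k bs → as ≡ bs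
lift-injective k {as} {bs} eq =
  map-injective (*-cancelˡ-≡ _ _ k) (∷ʳ-injectiveˡ (map (k *_) as) (map (k *_) bs) eq)

-- A lifted list contains the part 1, a list scaled by k > 1 does not.
scaled≢lift : ∀ k .{{_ : NonTrivial k}} j as bs → map (k *_) as ≢ lift j bs
scaled≢lift k j as bs eq
  with z , _ , 1≡kz ← ∈-map⁻ (k *_) (subst (1 ∈_) (sym eq) (∈-++⁺ʳ (map (j *_) bs) (here refl))) =
  nonTrivial⇒≢1 (∣1⇒≡1 (divides z (trans 1≡kz (*-comm k z))))

sum-divisible : ∀ {d} xs → All (d ∣_) xs → d ∣ sum xs
sum-divisible {d} []       []          = d ∣0
sum-divisible     (x ∷ xs) (d∣x ∷ d∣xs) = ∣m∣n⇒∣m+n d∣x (sum-divisible xs d∣xs)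

∤-below : ∀ {d n r} .{{_ : NonZero r}} → r < d → d ∣ n + r → ¬ d ∣ n
∤-below {n = n} r<d d∣n+r d∣n = <⇒≱ r<d (∣⇒≤ (∣m+n∣m⇒∣n {m = n} d∣n+r d∣n))

2∤odd : ∀ k → ¬ 2 ∣ suc (2 * k)
2∤odd k 2∣2k+1 = ∤-below {n = 2 * k} (s≤s (s≤s z≤n)) (subst (2 ∣_) (+-comm 1 (2 * k)) 2∣2k+1) (m∣m*n k)

-- If 3 divides k + 1, i.e. 2k + 2, then it divides neither 2k nor 2k + 1.
3∤2k,2k+1 : ∀ {k} → 3 ∣ suc k → ¬ 3 ∣ 2 * k × ¬ 3 ∣ suc (2 * k)
3∤2k,2k+1 {k} 3∣k+1 =
  ∤-below (s≤s (s≤s (s≤s z≤n))) 3∣2k+2 ,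
  ∤-below (s≤s (s≤s z≤n)) (subst (3 ∣_) (+-suc (2 * k) 1) 3∣2k+2)
  where
  3∣2k+2 : 3 ∣ 2 * k + 2
  3∣2k+2 = subst (3 ∣_) (trans (*-suc 2 k) (+-comm 2 (2 * k))) (∣-trans 3∣k+1 (n∣m*n 2))

-- If 3 divides k + 1 then every partition of 2k + 1 is a lifted partition
-- of k: its last part can be neither even (the sum is odd) nor a multiple
-- of 3, so it is 1; the remaining parts sum to 2k, which again excludes a
-- multiple of 3 as last part, and 1 occurs only once, so they are all even.
odd-partition-lifted : ∀ {k xs} → 3 ∣ suc k → IsSCPartition (suc (2 * k)) xs →
                       ∃ λ zs → xs ≡ lift 2 zs × IsSCPartition k zs
odd-partition-lifted {k} {xs} 3∣k+1 p@(sum≡ , _) with 3∤2k , 3∤2k+1 ← 3∤2k,2k+1 3∣k+1 | shape p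
... | empty = ⊥-elim (0≢1+n sum≡)
... | all-even 2∣xs = ⊥-elim (2∤odd k (subst (2 ∣_) sum≡ (sum-divisible xs 2∣xs)))
... | all-by-3 3∣xs = ⊥-elim (3∤2k+1 (subst (3 ∣_) sum≡ (sum-divisible xs 3∣xs)))
... | ends-in-1 ys with (q@(sum≡2k , _) , ys>1) ← Equivalence.from final-one p | shape q
...   | empty          = ⊥-elim (3∤2k (subst (3 ∣_) sum≡2k (3 ∣0)))
...   | all-by-3 3∣ys  = ⊥-elim (3∤2k (subst (3 ∣_) sum≡2k (sum-divisible ys 3∣ys)))
...   | ends-in-1 ws   = ⊥-elim (<-irrefl refl (All.head (AllProps.++⁻ʳ ws ys>1)))
...   | all-even 2∣ys with zs , refl ← divisible⇒scaled 2 ys 2∣ys =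
  zs , refl , Equivalence.from (scale-partition 2 Is23-×2) q

map-partitions : ∀ {n m U} (f : List ℕ → List ℕ) → (∀ {as bs} → f as ≡ f bs → as ≡ bs) →
                 (∀ {xs} → IsSCPartition m xs → IsSCPartition U (f xs)) →
                 Partitions n m → Partitions n U
map-partitions f f-injective f-valid (partitions L distinct valid refl) =
  partitions (map f L) (Unique.map⁺ f-injective distinct)
             (AllProps.map⁺ (All.map f-valid valid)) (length-map f L)

double-partitions : ∀ {n k} → Partitions n k → Partitions n (2 * k)
double-partitions = map-partitions (map (2 *_)) (map-injective (*-cancelˡ-≡ _ _ 2))
                                   (Equivalence.to (scale-partition 2 Is23-×2))

lift-partitions : ∀ {n k} → Partitions n k → Partitions n (suc (2 * k))
lift-partitions = map-partitions (lift 2) (lift-injective 2) (lift-partition 2 Is23-×2)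

mixed-partitions : ∀ {m n} k j → 2 * k ≡ suc (3 * j) →
                   Partitions m k → Partitions n j → Partitions (m + n) (2 * k)
mixed-partitions k j 2k≡3j+1 (partitions L dL vL refl) (partitions M dM vM refl) =
  partitions (map (map (2 *_)) L ++ map (lift 3) M)
    (Unique.++⁺ (Unique.map⁺ (map-injective (*-cancelˡ-≡ _ _ 2)) dL)
                (Unique.map⁺ (lift-injective 3) dM) doubled∩lifted≡∅)
    (AllProps.++⁺ (AllProps.map⁺ (All.map (Equivalence.to (scale-partition 2 Is23-×2)) vL))
                  (AllProps.map⁺ (All.map lifted vM)))
    (trans (length-++ (map (map (2 *_)) L)) (cong₂ _+_ (length-map _ L) (length-map _ M)))
  where
  lifted : ∀ {zs} → IsSCPartition j zs → IsSCPartition (2 * k) (lift 3 zs)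
  lifted {zs} q = subst (λ t → IsSCPartition t (lift 3 zs)) (sym 2k≡3j+1) (lift-partition 3 Is23-×3 q)
  doubled∩lifted≡∅ : ∀ {v} → ¬ (v ∈ map (map (2 *_)) L × v ∈ map (lift 3) M)
  doubled∩lifted≡∅ (v∈L , v∈M) with as , _ , refl ← ∈-map⁻ (map (2 *_)) v∈L
                                  | bs , _ , eq   ← ∈-map⁻ (lift 3) v∈M = scaled≢lift 2 3 as bs eq

by-computation : ∀ U L → {True (unique? L)} → {True (all? (isSCPartition? U) L)} →
                 Partitions (length L) U
by-computation U L {distinct} {valid} =
  partitions L (toWitness distinct) (toWitness valid) refl

-- If 3 divides k + 1, lifting is a bijection from the partitions of k
-- onto those of 2k + 1.
W-odd : ∀ {k} → 3 ∣ suc k → W (suc (2 * k)) ≡ W k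
W-odd {k} 3∣k+1 = ≤-antisym
  (subst (W (suc (2 * k)) ≤_) (length-map (lift 2) (Partitions.list (enumeration k)))
         (W≤length (map (lift 2) (Partitions.list (enumeration k))) lifted-from-k))
  (Partitions⇒≤W (lift-partitions (enumeration k)))
  where
  lifted-from-k : ∀ {xs} → IsSCPartition (suc (2 * k)) xs → xs ∈ map (lift 2) (Partitions.list (enumeration k))
  lifted-from-k p with zs , refl , q ← odd-partition-lifted 3∣k+1 p = ∈-map⁺ (lift 2) (∈enumeration q)

orbit : ℕ → ℕ → ℕ
orbit N zero    = N
orbit N (suc a) = suc (2 * orbit N a)

suc-orbit : ∀ N a → suc (orbit N a) ≡ 2 ^ a * suc N
suc-orbit N zero    = sym (*-identityˡ (suc N))
suc-orbit N (suc a) = begin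
  suc (suc (2 * orbit N a)) ≡⟨ sym (*-suc 2 (orbit N a)) ⟩
  2 * suc (orbit N a)       ≡⟨ cong (2 *_) (suc-orbit N a) ⟩
  2 * (2 ^ a * suc N)       ≡⟨ sym (*-assoc 2 (2 ^ a) (suc N)) ⟩
  2 ^ suc a * suc N         ∎
  where open ≡-Reasoning

orbit⇒closed-form : ∀ {U N} → (∃ λ a → U ≡ orbit N a) → ∃ λ a → U ≡ 2 ^ a * suc N ∸ 1
orbit⇒closed-form {N = N} (a , eq) = a , trans eq (cong (_∸ 1) (suc-orbit N a))

closed-form⇒orbit : ∀ {U N} → (∃ λ a → U ≡ 2 ^ a * suc N ∸ 1) → ∃ λ a → U ≡ orbit N a
closed-form⇒orbit {N = N} (a , eq) = a , trans eq (cong (_∸ 1) (sym (suc-orbit N a)))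

W-orbit : ∀ {N} → 3 ∣ suc N → ∀ a → W (orbit N a) ≡ W N
W-orbit         _     zero    = refl
W-orbit {N} 3∣N+1 (suc a) = trans (W-odd (subst (3 ∣_) (sym (suc-orbit N a)) (∣-trans 3∣N+1 (n∣m*n (2 ^ a)))))
                                   (W-orbit 3∣N+1 a)

double-orbit : ∀ c a → 2 * orbit (2 + 3 * c) a ≡ suc (3 * orbit c (suc a))
double-orbit c zero = ring c
  where
  ring : ∀ c → 2 * (2 + 3 * c) ≡ suc (3 * suc (2 * c))
  ring = solve-∀
double-orbit c (suc a) = begin
  2 * suc (2 * orbit (2 + 3 * c) a) ≡⟨ cong (λ t → 2 * suc t) (double-orbit c a) ⟩
  2 * suc (suc (3 * orbit c (suc a))) ≡⟨ ring (orbit c (suc a)) ⟩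
  suc (3 * suc (2 * orbit c (suc a))) ∎
  where
  open ≡-Reasoning
  ring : ∀ y → 2 * suc (suc (3 * y)) ≡ suc (3 * suc (2 * y))
  ring = solve-∀

parity : ∀ n → ∃ λ k → n ≡ 2 * k ⊎ n ≡ suc (2 * k)
parity zero = 0 , inj₁ refl
parity (suc n) with parity n
... | k , inj₁ refl = k , inj₂ refl
... | k , inj₂ refl = suc k , inj₁ (sym (*-suc 2 k))

binary-induction : (P : ℕ → Set) → P 0 → (∀ k → P k → P (2 * k)) → (∀ k → P k → P (suc (2 * k))) →
                   ∀ n → P n
binary-induction P P0 P-even P-odd = <-rec P step
  where
  step : ∀ n → (∀ {m} → m < n → P m) → P n
  step n rec with parity n
  ... | zero  , inj₁ refl = P0
  ... | suc k , inj₁ refl = P-even (suc k) (rec (m<m+n (suc k) z<s))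
  ... | k     , inj₂ refl = P-odd k (rec (s≤s (m≤m+n k (k + 0))))

-- Every number has a partition (its binary expansion).
partition-exists : ∀ n → Partitions 1 n
partition-exists = binary-induction (Partitions 1) (by-computation 0 ([] ∷ []))
                                    (λ _ → double-partitions) (λ _ → lift-partitions)

-- 2^(b+2) − 1 has at least two partitions, namely lifts of {3} and {2, 1}.
two-partitions-2^n-1 : ∀ b → Partitions 2 (orbit 0 (suc (suc b)))
two-partitions-2^n-1 zero    = by-computation 3 ((3 ∷ []) ∷ (2 ∷ 1 ∷ []) ∷ [])
two-partitions-2^n-1 (suc b) = lift-partitions (two-partitions-2^n-1 b)

-- The two families of the theorem, with 2^a (N + 1) − 1 written as orbit N a.
Family1 : ℕ → Set
Family1 U = (U ≡ 0 ⊎ U ≡ 1) ⊎ ∃ λ a → U ≡ orbit 2 a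

Family2 : ℕ → Set
Family2 U = (U ≡ 3 ⊎ U ≡ 4 ⊎ U ≡ 6 ⊎ U ≡ 7) ⊎ (∃ λ a → U ≡ orbit 8 a) ⊎ (∃ λ a → U ≡ orbit 14 a)

-- The orbits start at 2, 8, 14, which have 1, 2, 2 partitions (computed),
-- as do the small exceptions.
W-Family1 : ∀ {U} → Family1 U → W U ≡ 1
W-Family1 (inj₁ (inj₁ refl)) = refl
W-Family1 (inj₁ (inj₂ refl)) = refl
W-Family1 (inj₂ (a , refl))  = W-orbit (divides 1 refl) a

W-Family2 : ∀ {U} → Family2 U → W U ≡ 2
W-Family2 (inj₁ (inj₁ refl))                = refl
W-Family2 (inj₁ (inj₂ (inj₁ refl)))         = refl
W-Family2 (inj₁ (inj₂ (inj₂ (inj₁ refl)))) = refl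
W-Family2 (inj₁ (inj₂ (inj₂ (inj₂ refl)))) = refl
W-Family2 (inj₂ (inj₁ (a , refl)))          = W-orbit (divides 3 refl) a
W-Family2 (inj₂ (inj₂ (a , refl)))          = W-orbit (divides 5 refl) a

W-partitions : ∀ {n U} → W U ≡ n → Partitions n U
W-partitions {U = U} refl = enumeration U

Classified : ℕ → Set
Classified U = Family1 U ⊎ Family2 U ⊎ Partitions 3 U

-- Doubling: the family members map to family members, to 10 or 12 (three
-- partitions by computation), or to 2k = 3j + 1 where three partitions
-- arise by mixing doubled partitions of k with lifted partitions of j.
classify-double : ∀ k → Classified k → Classified (2 * k)
classify-double k (inj₁ (inj₁ (inj₁ refl))) = inj₁ (inj₁ (inj₁ refl))
classify-double k (inj₁ (inj₁ (inj₂ refl))) = inj₁ (inj₂ (0 , refl))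
classify-double k (inj₁ (inj₂ (zero , refl))) = inj₂ (inj₁ (inj₁ (inj₂ (inj₁ refl))))
classify-double k (inj₁ (inj₂ (suc zero , refl))) =
  inj₂ (inj₂ (by-computation 10 ((8 ∷ 2 ∷ []) ∷ (9 ∷ 1 ∷ []) ∷ (6 ∷ 3 ∷ 1 ∷ []) ∷ [])))
classify-double k (inj₁ (inj₂ (suc (suc a) , refl))) =
  inj₂ (inj₂ (mixed-partitions k _ (double-orbit 0 (suc (suc a))) (partition-exists k)
                               (two-partitions-2^n-1 (suc a))))
classify-double k (inj₂ (inj₁ (inj₁ (inj₁ refl)))) = inj₂ (inj₁ (inj₁ (inj₂ (inj₂ (inj₁ refl)))))
classify-double k (inj₂ (inj₁ (inj₁ (inj₂ (inj₁ refl))))) = inj₂ (inj₁ (inj₂ (inj₁ (0 , refl))))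
classify-double k (inj₂ (inj₁ (inj₁ (inj₂ (inj₂ (inj₁ refl)))))) =
  inj₂ (inj₂ (by-computation 12 ((12 ∷ []) ∷ (8 ∷ 4 ∷ []) ∷ (9 ∷ 3 ∷ []) ∷ [])))
classify-double k (inj₂ (inj₁ (inj₁ (inj₂ (inj₂ (inj₂ refl)))))) = inj₂ (inj₁ (inj₂ (inj₂ (0 , refl))))
classify-double k (inj₂ (inj₁ f@(inj₂ (inj₁ (a , refl))))) =
  inj₂ (inj₂ (mixed-partitions k _ (double-orbit 2 a) (W-partitions (W-Family2 f))
                               (partition-exists (orbit 2 (suc a)))))
classify-double k (inj₂ (inj₁ f@(inj₂ (inj₂ (a , refl))))) =
  inj₂ (inj₂ (mixed-partitions k _ (double-orbit 4 a) (W-partitions (W-Family2 f))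
                               (partition-exists (orbit 4 (suc a)))))
classify-double k (inj₂ (inj₂ P)) = inj₂ (inj₂ (double-partitions P))

classify-odd : ∀ k → Classified k → Classified (suc (2 * k))
classify-odd k (inj₁ (inj₁ (inj₁ refl))) = inj₁ (inj₁ (inj₂ refl))
classify-odd k (inj₁ (inj₁ (inj₂ refl))) = inj₂ (inj₁ (inj₁ (inj₁ refl)))
classify-odd k (inj₁ (inj₂ (a , refl)))  = inj₁ (inj₂ (suc a , refl))
classify-odd k (inj₂ (inj₁ (inj₁ (inj₁ refl)))) = inj₂ (inj₁ (inj₁ (inj₂ (inj₂ (inj₂ refl)))))
classify-odd k (inj₂ (inj₁ (inj₁ (inj₂ (inj₁ refl))))) =
  inj₂ (inj₂ (by-computation 9 ((9 ∷ []) ∷ (8 ∷ 1 ∷ []) ∷ (6 ∷ 3 ∷ []) ∷ [])))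
classify-odd k (inj₂ (inj₁ (inj₁ (inj₂ (inj₂ (inj₁ refl)))))) =
  inj₂ (inj₂ (by-computation 13 ((12 ∷ 1 ∷ []) ∷ (8 ∷ 4 ∷ 1 ∷ []) ∷ (9 ∷ 3 ∷ 1 ∷ []) ∷ [])))
classify-odd k (inj₂ (inj₁ (inj₁ (inj₂ (inj₂ (inj₂ refl)))))) =
  inj₂ (inj₂ (by-computation 15 ((12 ∷ 3 ∷ []) ∷ (8 ∷ 4 ∷ 2 ∷ 1 ∷ []) ∷ (12 ∷ 2 ∷ 1 ∷ []) ∷ [])))
classify-odd k (inj₂ (inj₁ (inj₂ (inj₁ (a , refl))))) = inj₂ (inj₁ (inj₂ (inj₁ (suc a , refl))))
classify-odd k (inj₂ (inj₁ (inj₂ (inj₂ (a , refl))))) = inj₂ (inj₁ (inj₂ (inj₂ (suc a , refl))))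
classify-odd k (inj₂ (inj₂ P)) = inj₂ (inj₂ (lift-partitions P))

classify : ∀ U → Classified U
classify = binary-induction Classified (inj₁ (inj₁ (inj₁ refl))) classify-double classify-odd

-- Since the three cases of the classification give W = 1, W = 2 and
-- W ≥ 3 respectively, W determines the case.
W≡1⇒Family1 : ∀ {U} → W U ≡ 1 → Family1 U
W≡1⇒Family1 {U} w with classify U
... | inj₁ f        = f
... | inj₂ (inj₁ f) with () ← trans (sym w) (W-Family2 f)
... | inj₂ (inj₂ P) with s≤s () ← subst (3 ≤_) w (Partitions⇒≤W P)

W≡2⇒Family2 : ∀ {U} → W U ≡ 2 → Family2 U
W≡2⇒Family2 {U} w with classify U
... | inj₂ (inj₁ f) = f
... | inj₁ f        with () ← trans (sym w) (W-Family1 f)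
... | inj₂ (inj₂ P) with s≤s (s≤s ()) ← subst (3 ≤_) w (Partitions⇒≤W P)

proposition5p4 : (U : ℕ) →
    ((W U ≡ 1) ⇔ ((U ≡ 0 ⊎ U ≡ 1) ⊎ ∃ λ a → U ≡ 2 ^ a * 3 ∸ 1))
    ×
    ((W U ≡ 2) ⇔ ((U ≡ 3 ⊎ U ≡ 4 ⊎ U ≡ 6 ⊎ U ≡ 7)
                  ⊎ (∃ λ a → U ≡ 2 ^ a * 9 ∸ 1)
                  ⊎ (∃ λ a → U ≡ 2 ^ a * 15 ∸ 1)))
proposition5p4 U =
  mk⇔ (λ w → map₂ orbit⇒closed-form (W≡1⇒Family1 w))
      (λ f → W-Family1 (map₂ closed-form⇒orbit f)) ,
  mk⇔ (λ w → map₂ (Sum.map orbit⇒closed-form orbit⇒closed-form) (W≡2⇒Family2 w))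
      (λ f → W-Family2 (map₂ (Sum.map closed-form⇒orbit closed-form⇒orbit) f))
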